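{- If two finite posets $P$ and $Q$ satisfy $U_P=U_Q$, then they have the same number of elements and the same number of comparable pairs.
   Context: A comparable pair of $P$ is a pair $\{i,j\}$ with $i<_Pj$. For a digraph $X=(V,E)$ with $|V|=n$, a $V$-listing is a bijection $\pi:[n]\to V$, and $X\mathrm{Des}(\pi)=\{i\in[n-1]:(\pi_i,\pi_{i+1})\in E\}$. Let $F_I=\sum_{i_1\le\dots\le i_n,\ i_j<i_{j+1}\ (j\in I)}x_{i_1}\cdots x_{i_n}$, and $U_X=\sum_\pi F_{X\mathrm{Des}(\pi)}$ over all $V$-listings. For a poset $P$, $U_P:=U_{D_P}$, where $D_P$ is the digraph on the elements of $P$ with edges $(i,j)$ for all $i<_Pj$. -}

module Defs where

open import Level using (0ℓ)
open import Data.Nat as ℕ using (ℕ; zero; suc; _+_)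
open import Data.Fin as Fin using (Fin; zero; suc; toℕ)
open import Data.Fin.Properties using (all?; any?) renaming (_≟_ to _≟F_)
open import Data.List using (List; []; _∷_; map; concatMap; allFin)
open import Data.Nat.ListAction using (sum)
open import Data.Product using (_×_; ∃)
open import Relation.Nullary using (Dec; yes; no; ¬_)
open import Relation.Nullary.Decidable using (_×-dec_; _→-dec_)
open import Relation.Unary using (Pred)
open import Relation.Binary using (Rel; IsStrictPartialOrder)
import Relation.Binary.Definitions as RD
open import Relation.Binary.PropositionalEquality using (_≡_)
import Data.Nat.Properties as ℕP

count : ∀ {A : Set} {P : A → Set} → ((x : A) → Dec (P x)) → List A → ℕ
count P? [] = 0
count P? (x ∷ xs) with P? x
... | yes _ = suc (count P? xs)
... | no  _ = count P? xs

consF : ∀ {n} {A : Set} → A → (Fin n → A) → Fin (suc n) → A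
consF a f zero    = a
consF a f (suc i) = f i

-- complete list of all functions Fin n → Fin k (each exactly once, up to extensionality)
allFuns : (n k : ℕ) → List (Fin n → Fin k)
allFuns zero    k = (λ ()) ∷ []
allFuns (suc n) k = concatMap (λ f → map (λ c → consF c f) (allFin k)) (allFuns n k)

record Digraph (n : ℕ) : Set₁ where
  field
    Edge  : Rel (Fin n) 0ℓ
    edge? : RD.Decidable Edge

record FinPoset : Set₁ where
  field
    size  : ℕ
    _<P_  : Rel (Fin size) 0ℓ
    <P?   : RD.Decidable _<P_
    isSPO : IsStrictPartialOrder _≡_ _<P_

D : (P : FinPoset) → Digraph (FinPoset.size P)
D P = record { Edge = FinPoset._<P_ P ; edge? = FinPoset.<P? P }

-- number of comparable pairs {i,j} with i <_P j
-- (each comparable pair is counted once, as the ordered pair (i,j) with i <_P j)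
comparablePairs : FinPoset → ℕ
comparablePairs P =
  count (λ ij → FinPoset.<P? P (Data.Product.proj₁ ij) (Data.Product.proj₂ ij))
        (concatMap (λ i → map (λ j → (i Data.Product., j)) (allFin n)) (allFin n))
  where
    n = FinPoset.size P
    import Data.Product

IsBijection : ∀ {n} → (Fin n → Fin n) → Set
IsBijection {n} π = (∀ i j → π i ≡ π j → i ≡ j) × (∀ v → ∃ λ i → π i ≡ v)

isBijection? : ∀ {n} (π : Fin n → Fin n) → Dec (IsBijection π)
isBijection? π =
  all? (λ i → all? (λ j → (π i ≟F π j) →-dec (i ≟F j)))
  ×-dec all? (λ v → any? (λ i → π i ≟F v))

-- positions i, i+1 of [n] (0-indexed here)
Adj : ∀ {n} → Fin n → Fin n → Set
Adj i j = toℕ j ≡ suc (toℕ i)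

adj? : ∀ {n} (i j : Fin n) → Dec (Adj i j)
adj? i j = toℕ j ℕP.≟ suc (toℕ i)

-- A monomial x_1^{α_1} ⋯ x_k^{α_k} is given by k and α : Fin k → ℕ
-- (every monomial arises this way).  A sequence i_1 ≤ ⋯ ≤ i_n of
-- variable indices (all ≤ k, as otherwise the monomial is not x^α)
-- is s : Fin n → Fin k.

HasContent : ∀ {n k} → (Fin n → Fin k) → (Fin k → ℕ) → Set
HasContent {n} s α = ∀ c → count (λ j → s j ≟F c) (allFin n) ≡ α c

-- s is a term of F_{XDes(π)}: weakly increasing, strictly increasing at
-- every position i with (π_i , π_{i+1}) ∈ E
CompatibleSeq : ∀ {n k} → Digraph n → (Fin n → Fin n) → (Fin n → Fin k) → Set
CompatibleSeq X π s =
  ∀ i j → Adj i j →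
    (toℕ (s i) ℕ.≤ toℕ (s j)) × (Digraph.Edge X (π i) (π j) → toℕ (s i) ℕ.< toℕ (s j))

compatibleSeq? : ∀ {n k} (X : Digraph n) π (s : Fin n → Fin k) → Dec (CompatibleSeq X π s)
compatibleSeq? X π s =
  all? (λ i → all? (λ j → adj? i j →-dec
    ((toℕ (s i) ℕ.≤? toℕ (s j)) ×-dec (Digraph.edge? X (π i) (π j) →-dec (toℕ (s i) ℕ.<? toℕ (s j))))))

hasContent? : ∀ {n k} (s : Fin n → Fin k) α → Dec (HasContent s α)
hasContent? s α = all? (λ c → _ ℕP.≟ α c)

coeffF : ∀ {n} → Digraph n → (Fin n → Fin n) → (k : ℕ) → (Fin k → ℕ) → ℕ
coeffF {n} X π k α =
  count (λ s → compatibleSeq? X π s ×-dec hasContent? s α) (allFuns n k)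

-- coefficient of x^α in U_X = Σ_π F_{XDes(π)} over all V-listings π
coeffU : ∀ {n} → Digraph n → (k : ℕ) → (Fin k → ℕ) → ℕ
coeffU {n} X k α =
  sum (map (λ π → coeffF X π k α) (filterBij (allFuns n n)))
  where
    filterBij : List (Fin n → Fin n) → List (Fin n → Fin n)
    filterBij [] = []
    filterBij (π ∷ πs) with isBijection? π
    ... | yes _ = π ∷ filterBij πs
    ... | no  _ = filterBij πs

-- U_P := U_{D_P}; equality of formal power series = equality of all coefficients
U-Equal : FinPoset → FinPoset → Set
U-Equal P Q = ∀ k (α : Fin k → ℕ) → coeffU (D P) k α ≡ coeffU (D Q) k α

{-# OPTIONS --safe #-}

-- Let X have n vertices.  A sequence counted by the coefficient of x₁ ⋯ x_k in U_X takes each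
-- of k values exactly once at n positions, so this coefficient vanishes unless k ≤ n, while
-- for k = n the identity listing and sequence contribute; hence U_X determines n.
-- For n ≥ 2 the only weakly increasing sequence with content x₁² x₂ ⋯ x_{n-1} is
-- 1, 1, 2, …, n-1, and it is compatible with a listing π exactly when (π₁, π₂) is not an edge.
-- As X is irreflexive, every edge (a, b) is the start of the same positive number (n-2)! of
-- listings, so this coefficient is n! - e (n-2)! for e edges, and it determines e.

module Submission where

open import Defs
open import Data.Nat as ℕ using (ℕ; zero; suc; _+_; _*_; _≤_; _<_; z≤n; s≤s)
import Data.Nat.Properties as ℕP
open import Data.Nat.ListAction using (sum)
open import Data.Nat.ListAction.Properties using (sum-++)
open import Data.Fin as Fin using (Fin; zero; suc; toℕ)
import Data.Fin.Properties as FinP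
open import Data.Fin.Properties using (_≟_)
open import Data.Fin.Permutation as Perm using (Permutation; _⟨$⟩ʳ_; _⟨$⟩ˡ_)
open import Data.List using (List; []; _∷_; map; concatMap; allFin; _++_)
open import Data.List.Properties using (map-++; map-tabulate)
open import Data.List.Membership.Propositional using (_∈_)
open import Data.List.Membership.Propositional.Properties using (∈-allFin)
open import Data.List.Relation.Unary.Any using (here; there)
open import Data.Product using (_×_; _,_; proj₁; proj₂; ∃)
open import Data.Empty using (⊥-elim)
open import Function using (_∘_; _⇔_; mk⇔; Equivalence; Injection)
open import Function.Properties.Inverse using (↔⇒↣)
open import Relation.Nullary using (Dec; yes; no; ¬_; ¬?)
open import Relation.Nullary.Decidable using (_×-dec_)
open import Relation.Binary using (IsStrictPartialOrder)
open import Relation.Binary.PropositionalEquality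
  using (_≡_; _≢_; _≗_; refl; sym; trans; cong; cong₂; subst; subst₂; module ≡-Reasoning)
open import Algebra.Properties.CommutativeSemigroup ℕP.+-commutativeSemigroup
  using () renaming (interchange to +-interchange)
import Algebra.Properties.CommutativeMonoid.Sum ℕP.+-0-commutativeMonoid as FinSum

private
  variable
    A B : Set
    n m k : ℕ

𝟙 : Dec A → ℕ
𝟙 (yes _) = 1
𝟙 (no _)  = 0

𝟙-yes : (d : Dec A) → A → 𝟙 d ≡ 1
𝟙-yes (yes _) _ = refl
𝟙-yes (no ¬a) a = ⊥-elim (¬a a)

𝟙-no : (d : Dec A) → ¬ A → 𝟙 d ≡ 0
𝟙-no (yes a) ¬a = ⊥-elim (¬a a)
𝟙-no (no _)  _  = refl

𝟙-cong : (d : Dec A) (e : Dec B) → (A → B) → (B → A) → 𝟙 d ≡ 𝟙 e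
𝟙-cong (yes _) (yes _) _ _ = refl
𝟙-cong (yes a) (no ¬b) f _ = ⊥-elim (¬b (f a))
𝟙-cong (no ¬a) (yes b) _ g = ⊥-elim (¬a (g b))
𝟙-cong (no _)  (no _)  _ _ = refl

𝟙-¬?+𝟙 : (d : Dec A) → 𝟙 (¬? d) + 𝟙 d ≡ 1
𝟙-¬?+𝟙 (yes _) = refl
𝟙-¬?+𝟙 (no _)  = refl

𝟙≢0⇒ : (d : Dec A) → 𝟙 d ≢ 0 → A
𝟙≢0⇒ (yes a) _   = a
𝟙≢0⇒ (no _)  1≢0 = ⊥-elim (1≢0 refl)

∑-syntax : List A → (A → ℕ) → ℕ
∑-syntax xs f = sum (map f xs)

syntax ∑-syntax xs (λ x → e) = ∑[ x ∈ xs ] e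

count≡∑𝟙 : {P : A → Set} (P? : ∀ x → Dec (P x)) (xs : List A) →
           count P? xs ≡ ∑[ x ∈ xs ] 𝟙 (P? x)
count≡∑𝟙 P? []       = refl
count≡∑𝟙 P? (x ∷ xs) with P? x
... | yes _ = cong suc (count≡∑𝟙 P? xs)
... | no  _ = count≡∑𝟙 P? xs

∑-cong : ∀ (xs : List A) {f g : A → ℕ} → (∀ x → f x ≡ g x) → ∑[ x ∈ xs ] f x ≡ ∑[ x ∈ xs ] g x
∑-cong []       f≡g = refl
∑-cong (x ∷ xs) f≡g = cong₂ _+_ (f≡g x) (∑-cong xs f≡g)

∑-zero : ∀ (xs : List A) {f : A → ℕ} → (∀ x → f x ≡ 0) → ∑[ x ∈ xs ] f x ≡ 0
∑-zero []       f≡0 = refl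
∑-zero (x ∷ xs) f≡0 = cong₂ _+_ (f≡0 x) (∑-zero xs f≡0)

∑-+ : ∀ (xs : List A) (f g : A → ℕ) → ∑[ x ∈ xs ] (f x + g x) ≡ ∑[ x ∈ xs ] f x + ∑[ x ∈ xs ] g x
∑-+ []       f g = refl
∑-+ (x ∷ xs) f g = begin
  (f x + g x) + ∑[ y ∈ xs ] (f y + g y)           ≡⟨ cong ((f x + g x) +_) (∑-+ xs f g) ⟩
  (f x + g x) + (∑[ y ∈ xs ] f y + ∑[ y ∈ xs ] g y) ≡⟨ +-interchange (f x) (g x) _ _ ⟩
  (f x + ∑[ y ∈ xs ] f y) + (g x + ∑[ y ∈ xs ] g y) ∎
  where open ≡-Reasoning

∑-*ˡ : ∀ (xs : List A) c (f : A → ℕ) → ∑[ x ∈ xs ] (c * f x) ≡ c * ∑[ x ∈ xs ] f x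
∑-*ˡ []       c f = sym (ℕP.*-zeroʳ c)
∑-*ˡ (x ∷ xs) c f = trans (cong (c * f x +_) (∑-*ˡ xs c f)) (sym (ℕP.*-distribˡ-+ c (f x) _))

∑-*ʳ : ∀ (xs : List A) (f : A → ℕ) c → ∑[ x ∈ xs ] (f x * c) ≡ (∑[ x ∈ xs ] f x) * c
∑-*ʳ []       f c = refl
∑-*ʳ (x ∷ xs) f c = trans (cong (f x * c +_) (∑-*ʳ xs f c)) (sym (ℕP.*-distribʳ-+ c (f x) _))

∑-++ : ∀ (xs ys : List A) (f : A → ℕ) → ∑[ x ∈ xs ++ ys ] f x ≡ ∑[ x ∈ xs ] f x + ∑[ x ∈ ys ] f x
∑-++ xs ys f = trans (cong sum (map-++ f xs ys)) (sum-++ (map f xs) (map f ys))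

∑-concatMap : ∀ (g : A → List B) (xs : List A) (f : B → ℕ) →
              ∑[ y ∈ concatMap g xs ] f y ≡ ∑[ x ∈ xs ] ∑[ y ∈ g x ] f y
∑-concatMap g []       f = refl
∑-concatMap g (x ∷ xs) f =
  trans (∑-++ (g x) (concatMap g xs) f) (cong (∑[ y ∈ g x ] f y +_) (∑-concatMap g xs f))

∑-map : ∀ (g : A → B) (xs : List A) (f : B → ℕ) → ∑[ y ∈ map g xs ] f y ≡ ∑[ x ∈ xs ] f (g x)
∑-map g []       f = refl
∑-map g (x ∷ xs) f = cong (f (g x) +_) (∑-map g xs f)

∑-comm : ∀ (xs : List A) (ys : List B) (f : A → B → ℕ) →
         ∑[ x ∈ xs ] ∑[ y ∈ ys ] f x y ≡ ∑[ y ∈ ys ] ∑[ x ∈ xs ] f x y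
∑-comm []       ys f = sym (∑-zero ys (λ _ → refl))
∑-comm (x ∷ xs) ys f = trans (cong (∑[ y ∈ ys ] f x y +_) (∑-comm xs ys f)) (sym (∑-+ ys (f x) _))

∑-≥ : ∀ {xs : List A} (f : A → ℕ) {x} → x ∈ xs → f x ≤ ∑[ y ∈ xs ] f y
∑-≥ f (here refl) = ℕP.m≤m+n _ _
∑-≥ f (there x∈xs) = ℕP.≤-trans (∑-≥ f x∈xs) (ℕP.m≤n+m _ _)

∑≢0⇒∃ : ∀ (xs : List A) (f : A → ℕ) → ∑[ x ∈ xs ] f x ≢ 0 → ∃ λ x → f x ≢ 0
∑≢0⇒∃ []       f ∑≢0 = ⊥-elim (∑≢0 refl)
∑≢0⇒∃ (x ∷ xs) f ∑≢0 with f x ℕ.≟ 0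
... | no  fx≢0 = x , fx≢0
... | yes fx≡0 = ∑≢0⇒∃ xs f (λ ∑≡0 → ∑≢0 (cong₂ _+_ fx≡0 ∑≡0))

count≢0⇒∃ : {P : A → Set} (P? : ∀ x → Dec (P x)) (xs : List A) → count P? xs ≢ 0 → ∃ P
count≢0⇒∃ P? xs count≢0 =
  let x , 𝟙≢0 = ∑≢0⇒∃ xs (λ x → 𝟙 (P? x)) (count≢0 ∘ trans (count≡∑𝟙 P? xs))
  in  x , 𝟙≢0⇒ (P? x) 𝟙≢0

count-≗ : ∀ {P Q : A → Set} (P? : ∀ x → Dec (P x)) (Q? : ∀ x → Dec (Q x)) (xs : List A) →
          (∀ x → P x → Q x) → (∀ x → Q x → P x) → count P? xs ≡ count Q? xs
count-≗ P? Q? xs P⇒Q Q⇒P = begin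
  count P? xs            ≡⟨ count≡∑𝟙 P? xs ⟩
  ∑[ x ∈ xs ] 𝟙 (P? x)   ≡⟨ ∑-cong xs (λ x → 𝟙-cong (P? x) (Q? x) (P⇒Q x) (Q⇒P x)) ⟩
  ∑[ x ∈ xs ] 𝟙 (Q? x)   ≡⟨ count≡∑𝟙 Q? xs ⟨
  count Q? xs            ∎
  where open ≡-Reasoning

∑-allFin-suc : ∀ (f : Fin (suc n) → ℕ) →
               ∑[ i ∈ allFin (suc n) ] f i ≡ f zero + ∑[ i ∈ allFin n ] f (suc i)
∑-allFin-suc {n} f =
  cong (λ xs → f zero + sum xs) (trans (map-tabulate suc f) (sym (map-tabulate (λ i → i) (f ∘ suc))))

∑-allFin≡sum : ∀ (f : Fin n → ℕ) → ∑[ i ∈ allFin n ] f i ≡ FinSum.sum f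
∑-allFin≡sum {zero}  f = refl
∑-allFin≡sum {suc n} f = trans (∑-allFin-suc f) (cong (f zero +_) (∑-allFin≡sum (f ∘ suc)))

∑-allFin-permute : ∀ (τ : Permutation n n) (f : Fin n → ℕ) →
                   ∑[ i ∈ allFin n ] f (τ ⟨$⟩ʳ i) ≡ ∑[ i ∈ allFin n ] f i
∑-allFin-permute τ f = begin
  ∑[ i ∈ allFin _ ] f (τ ⟨$⟩ʳ i) ≡⟨ ∑-allFin≡sum (f ∘ (τ ⟨$⟩ʳ_)) ⟩
  FinSum.sum (f ∘ (τ ⟨$⟩ʳ_))     ≡⟨ FinSum.sum-permute f τ ⟨
  FinSum.sum f                   ≡⟨ ∑-allFin≡sum f ⟨
  ∑[ i ∈ allFin _ ] f i          ∎
  where open ≡-Reasoning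

∑-allFin-single : ∀ (f : Fin n → ℕ) x → (∀ i → i ≢ x → f i ≡ 0) → ∑[ i ∈ allFin n ] f i ≡ f x
∑-allFin-single {suc n} f zero f≡0 = begin
  ∑[ i ∈ allFin (suc n) ] f i          ≡⟨ ∑-allFin-suc f ⟩
  f zero + ∑[ i ∈ allFin n ] f (suc i) ≡⟨ cong (f zero +_) (∑-zero (allFin n) λ i → f≡0 (suc i) λ ()) ⟩
  f zero + 0                           ≡⟨ ℕP.+-identityʳ (f zero) ⟩
  f zero                               ∎
  where open ≡-Reasoning
∑-allFin-single {suc n} f (suc x) f≡0 = begin
  ∑[ i ∈ allFin (suc n) ] f i          ≡⟨ ∑-allFin-suc f ⟩
  f zero + ∑[ i ∈ allFin n ] f (suc i)
    ≡⟨ cong₂ _+_ (f≡0 zero λ ())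
                 (∑-allFin-single (f ∘ suc) x λ i i≢x → f≡0 (suc i) (i≢x ∘ FinP.suc-injective)) ⟩
  f (suc x)                            ∎
  where open ≡-Reasoning

∑-allFin-sift : ∀ (f : Fin n → ℕ) x → ∑[ i ∈ allFin n ] (f i * 𝟙 (x ≟ i)) ≡ f x
∑-allFin-sift f x = begin
  ∑[ i ∈ allFin _ ] (f i * 𝟙 (x ≟ i)) ≡⟨ ∑-allFin-single _ x off-x ⟩
  f x * 𝟙 (x ≟ x)                     ≡⟨ cong (f x *_) (𝟙-yes (x ≟ x) refl) ⟩
  f x * 1                             ≡⟨ ℕP.*-identityʳ (f x) ⟩
  f x                                 ∎
  where
    open ≡-Reasoning
    off-x : ∀ i → i ≢ x → f i * 𝟙 (x ≟ i) ≡ 0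
    off-x i i≢x = trans (cong (f i *_) (𝟙-no (x ≟ i) (i≢x ∘ sym))) (ℕP.*-zeroʳ (f i))

∑-fibres : ∀ (s : Fin n → Fin k) (g : Fin k → ℕ) →
           ∑[ i ∈ allFin n ] g (s i) ≡ ∑[ c ∈ allFin k ] (g c * count (λ j → s j ≟ c) (allFin n))
∑-fibres {n} {k} s g = begin
  ∑[ i ∈ allFin n ] g (s i)
    ≡⟨ ∑-cong (allFin n) (λ i → ∑-allFin-sift g (s i)) ⟨
  ∑[ i ∈ allFin n ] ∑[ c ∈ allFin k ] (g c * 𝟙 (s i ≟ c))
    ≡⟨ ∑-comm (allFin n) (allFin k) _ ⟩
  ∑[ c ∈ allFin k ] ∑[ i ∈ allFin n ] (g c * 𝟙 (s i ≟ c))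
    ≡⟨ ∑-cong (allFin k) (λ c → ∑-*ˡ (allFin n) (g c) _) ⟩
  ∑[ c ∈ allFin k ] (g c * ∑[ i ∈ allFin n ] 𝟙 (s i ≟ c))
    ≡⟨ ∑-cong (allFin k) (λ c → cong (g c *_) (count≡∑𝟙 _ (allFin n))) ⟨
  ∑[ c ∈ allFin k ] (g c * count (λ j → s j ≟ c) (allFin n))
    ∎
  where open ≡-Reasoning

Respects≗ : ((Fin n → Fin k) → ℕ) → Set
Respects≗ g = ∀ {f f′} → f ≗ f′ → g f ≡ g f′

𝟙-respects≗ : {P : (Fin n → Fin k) → Set} (P? : ∀ f → Dec (P f)) →
              (∀ {f f′} → f ≗ f′ → P f → P f′) → Respects≗ (λ f → 𝟙 (P? f))
𝟙-respects≗ P? transport f≗f′ = 𝟙-cong (P? _) (P? _) (transport f≗f′) (transport (sym ∘ f≗f′))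

*-respects≗ : {g h : (Fin n → Fin k) → ℕ} →
              Respects≗ g → Respects≗ h → Respects≗ (λ f → g f * h f)
*-respects≗ g-resp h-resp f≗f′ = cong₂ _*_ (g-resp f≗f′) (h-resp f≗f′)

consF-cong : ∀ (c : Fin k) {f f′ : Fin n → Fin k} → f ≗ f′ → consF c f ≗ consF c f′
consF-cong c f≗f′ zero    = refl
consF-cong c f≗f′ (suc i) = f≗f′ i

consF-head-tail : ∀ (f : Fin (suc n) → Fin k) → f ≗ consF (f zero) (f ∘ suc)
consF-head-tail f zero    = refl
consF-head-tail f (suc i) = refl

∑-consF-respects≗ : ∀ {g : (Fin (suc n) → Fin k) → ℕ} → Respects≗ g →
                    Respects≗ (λ f → ∑[ c ∈ allFin k ] g (consF c f))
∑-consF-respects≗ {k = k} g-resp f≗f′ = ∑-cong (allFin k) (λ c → g-resp (consF-cong c f≗f′))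

∑-allFuns-suc : ∀ (g : (Fin (suc n) → Fin k) → ℕ) →
                ∑[ f ∈ allFuns (suc n) k ] g f ≡ ∑[ f ∈ allFuns n k ] ∑[ c ∈ allFin k ] g (consF c f)
∑-allFuns-suc {n} {k} g = trans (∑-concatMap _ (allFuns n k) g)
                                (∑-cong (allFuns n k) (λ f → ∑-map (λ c → consF c f) (allFin k) g))

∑-allFuns-≥ : ∀ (g : (Fin n → Fin k) → ℕ) → Respects≗ g → ∀ f → g f ≤ ∑[ f′ ∈ allFuns n k ] g f′
∑-allFuns-≥ {zero}      g g-resp f = ℕP.≤-trans (ℕP.≤-reflexive (g-resp (λ ()))) (ℕP.m≤m+n _ 0)
∑-allFuns-≥ {suc n} {k} g g-resp f = begin
  g f
    ≡⟨ g-resp (consF-head-tail f) ⟩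
  g (consF (f zero) (f ∘ suc))
    ≤⟨ ∑-≥ (λ c → g (consF c (f ∘ suc))) (∈-allFin (f zero)) ⟩
  ∑[ c ∈ allFin k ] g (consF c (f ∘ suc))
    ≤⟨ ∑-allFuns-≥ _ (∑-consF-respects≗ g-resp) (f ∘ suc) ⟩
  ∑[ f′ ∈ allFuns n k ] ∑[ c ∈ allFin k ] g (consF c f′)
    ≡⟨ ∑-allFuns-suc g ⟨
  ∑[ f′ ∈ allFuns (suc n) k ] g f′
    ∎
  where open ℕP.≤-Reasoning

∑-allFuns-single : ∀ (g : (Fin n → Fin k) → ℕ) → Respects≗ g → ∀ f₀ →
                   (∀ f → ¬ f ≗ f₀ → g f ≡ 0) → ∑[ f ∈ allFuns n k ] g f ≡ g f₀
∑-allFuns-single {zero}      g g-resp f₀ g≡0 = trans (ℕP.+-identityʳ _) (g-resp (λ ()))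
∑-allFuns-single {suc n} {k} g g-resp f₀ g≡0 = begin
  ∑[ f ∈ allFuns (suc n) k ] g f
    ≡⟨ ∑-allFuns-suc g ⟩
  ∑[ f ∈ allFuns n k ] ∑[ c ∈ allFin k ] g (consF c f)
    ≡⟨ ∑-allFuns-single _ (∑-consF-respects≗ g-resp) (f₀ ∘ suc) off-f₀-tail ⟩
  ∑[ c ∈ allFin k ] g (consF c (f₀ ∘ suc))
    ≡⟨ ∑-allFin-single _ (f₀ zero) off-f₀-head ⟩
  g (consF (f₀ zero) (f₀ ∘ suc))
    ≡⟨ g-resp (consF-head-tail f₀) ⟨
  g f₀
    ∎
  where
    open ≡-Reasoning
    off-f₀-tail : ∀ f → ¬ f ≗ f₀ ∘ suc → ∑[ c ∈ allFin k ] g (consF c f) ≡ 0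
    off-f₀-tail f f≉ = ∑-zero (allFin k) (λ c → g≡0 (consF c f) (λ f≗ → f≉ (f≗ ∘ suc)))
    off-f₀-head : ∀ c → c ≢ f₀ zero → g (consF c (f₀ ∘ suc)) ≡ 0
    off-f₀-head c c≢ = g≡0 (consF c (f₀ ∘ suc)) (λ f≗ → c≢ (f≗ zero))

∑-allFuns-permute : ∀ (τ : Permutation k k) (g : (Fin n → Fin k) → ℕ) → Respects≗ g →
                    ∑[ f ∈ allFuns n k ] g ((τ ⟨$⟩ʳ_) ∘ f) ≡ ∑[ f ∈ allFuns n k ] g f
∑-allFuns-permute {n = zero}      τ g g-resp = cong (_+ 0) (g-resp (λ ()))
∑-allFuns-permute {k} {suc n} τ g g-resp = begin
  ∑[ f ∈ allFuns (suc n) k ] g ((τ ⟨$⟩ʳ_) ∘ f)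
    ≡⟨ ∑-allFuns-suc (λ f → g ((τ ⟨$⟩ʳ_) ∘ f)) ⟩
  ∑[ f ∈ allFuns n k ] ∑[ c ∈ allFin k ] g ((τ ⟨$⟩ʳ_) ∘ consF c f)
    ≡⟨ ∑-cong (allFuns n k) (λ f → ∑-cong (allFin k) (λ c → g-resp (τ∘consF c f))) ⟩
  ∑[ f ∈ allFuns n k ] h ((τ ⟨$⟩ʳ_) ∘ f)
    ≡⟨ ∑-allFuns-permute τ h h-resp ⟩
  ∑[ f ∈ allFuns n k ] h f
    ≡⟨ ∑-cong (allFuns n k) (λ f → ∑-allFin-permute τ (λ c → g (consF c f))) ⟩
  ∑[ f ∈ allFuns n k ] ∑[ c ∈ allFin k ] g (consF c f)
    ≡⟨ ∑-allFuns-suc g ⟨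
  ∑[ f ∈ allFuns (suc n) k ] g f
    ∎
  where
    open ≡-Reasoning
    h : (Fin n → Fin k) → ℕ
    h f = ∑[ c ∈ allFin k ] g (consF (τ ⟨$⟩ʳ c) f)
    h-resp : Respects≗ h
    h-resp f≗f′ = ∑-cong (allFin k) (λ c → g-resp (consF-cong (τ ⟨$⟩ʳ c) f≗f′))
    τ∘consF : ∀ c f → (τ ⟨$⟩ʳ_) ∘ consF c f ≗ consF (τ ⟨$⟩ʳ c) ((τ ⟨$⟩ʳ_) ∘ f)
    τ∘consF c f zero    = refl
    τ∘consF c f (suc i) = refl

WeaklyIncreasing : (Fin n → Fin k) → Set
WeaklyIncreasing {n} s = ∀ (i j : Fin n) → Adj i j → s i Fin.≤ s j

weaklyIncreasing-tail : ∀ {s : Fin (suc n) → Fin k} →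
                        WeaklyIncreasing s → WeaklyIncreasing (s ∘ suc)
weaklyIncreasing-tail increasing i j adj = increasing (suc i) (suc j) (cong suc adj)

weaklyIncreasing⇒monotone : ∀ {s : Fin n → Fin k} → WeaklyIncreasing s →
                            ∀ {i j} → i Fin.≤ j → s i Fin.≤ s j
weaklyIncreasing⇒monotone               s↑ {zero}  {zero}   _         = ℕP.≤-refl
weaklyIncreasing⇒monotone {suc zero}    s↑ {zero}  {suc ()} _
weaklyIncreasing⇒monotone {suc (suc n)} s↑ {zero}  {suc j}  _         =
  ℕP.≤-trans (s↑ zero (suc zero) refl)
             (weaklyIncreasing⇒monotone (weaklyIncreasing-tail s↑) {zero} {j} z≤n)
weaklyIncreasing⇒monotone               s↑ {suc i} {suc j}  (s≤s i≤j) =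
  weaklyIncreasing⇒monotone (weaklyIncreasing-tail s↑) i≤j

downwardClosed⇒initialSegment : ∀ {P : Fin n → Set} (P? : ∀ i → Dec (P i)) →
                                (∀ {i j} → i Fin.≤ j → P j → P i) →
                                ∀ i → P i ⇔ toℕ i < ∑[ j ∈ allFin n ] 𝟙 (P? j)
downwardClosed⇒initialSegment {suc n} {P} P? closed i
  rewrite ∑-allFin-suc (λ j → 𝟙 (P? j))
  with P? zero | i
... | yes P₀ | zero  = mk⇔ (λ _ → s≤s z≤n) (λ _ → P₀)
... | yes P₀ | suc i = mk⇔ (s≤s ∘ Equivalence.to segment) (Equivalence.from segment ∘ ℕP.≤-pred)
  where
    segment : P (suc i) ⇔ toℕ i < ∑[ j ∈ allFin n ] 𝟙 (P? (suc j))
    segment = downwardClosed⇒initialSegment (P? ∘ suc) (closed ∘ s≤s) i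
... | no ¬P₀ | i     = mk⇔ (λ Pi → ⊥-elim (¬P₀ (closed z≤n Pi)))
                           (λ i<tail → ⊥-elim (ℕP.n≮0 (subst (toℕ i <_) tail≡0 i<tail)))
  where
    tail≡0 : ∑[ j ∈ allFin n ] 𝟙 (P? (suc j)) ≡ 0
    tail≡0 = ∑-zero (allFin n) (λ j → 𝟙-no (P? (suc j)) (¬P₀ ∘ closed z≤n))

-- A weakly increasing sequence takes values ≤ v exactly on an initial segment, whose length
-- the content determines.
weaklyIncreasing-determined-by-content : ∀ (α : Fin k → ℕ) {s s′ : Fin n → Fin k} →
  WeaklyIncreasing s → WeaklyIncreasing s′ → HasContent s α → HasContent s′ α → s ≗ s′
weaklyIncreasing-determined-by-content {k} {n} α s↑ s′↑ s-content s′-content i =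
  FinP.≤-antisym (bounded s↑ s-content s′↑ s′-content) (bounded s′↑ s′-content s↑ s-content)
  where
    segmentLength : Fin k → ℕ
    segmentLength v = ∑[ c ∈ allFin k ] (𝟙 (c Fin.≤? v) * α c)

    below : ∀ {t : Fin n → Fin k} → WeaklyIncreasing t → HasContent t α →
            ∀ v j → t j Fin.≤ v ⇔ toℕ j < segmentLength v
    below {t} t↑ t-content v j = subst (λ N → t j Fin.≤ v ⇔ toℕ j < N) count-below
      (downwardClosed⇒initialSegment (λ j → t j Fin.≤? v)
        (λ j≤j′ tj′≤v → FinP.≤-trans (weaklyIncreasing⇒monotone t↑ j≤j′) tj′≤v) j)
      where
        count-below : ∑[ j ∈ allFin n ] 𝟙 (t j Fin.≤? v) ≡ segmentLength v
        count-below = trans (∑-fibres t (λ c → 𝟙 (c Fin.≤? v)))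
                            (∑-cong (allFin k) (λ c → cong (𝟙 (c Fin.≤? v) *_) (t-content c)))

    bounded : ∀ {t t′ : Fin n → Fin k} → WeaklyIncreasing t → HasContent t α →
              WeaklyIncreasing t′ → HasContent t′ α → t i Fin.≤ t′ i
    bounded {t′ = t′} t↑ t-content t′↑ t′-content =
      Equivalence.from (below t↑ t-content (t′ i) i)
        (Equivalence.to (below t′↑ t′-content (t′ i) i) FinP.≤-refl)

-- The filter inside coeffU is local to its definition and cannot be named.  Its reduction
-- rules are passed as refl; abstracting over isBijection? π in coeffU≡∑ makes the cons case
-- S∷ a pattern, so unification recovers S∷ (and then S).
∑-filter-cons : ∀ {P : A → Set} (P? : ∀ x → Dec (P x)) (h : A → ℕ)
                {S : List A → ℕ} {S∷ : ∀ x → List A → Dec (P x) → ℕ} →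
                S [] ≡ 0 →
                (∀ x xs → S (x ∷ xs) ≡ S∷ x xs (P? x)) →
                (∀ x xs p → S∷ x xs (yes p) ≡ h x + S xs) →
                (∀ x xs p → S∷ x xs (no p) ≡ S xs) →
                ∀ x xs d → S∷ x xs d ≡ 𝟙 d * h x + ∑[ y ∈ xs ] (𝟙 (P? y) * h y)
∑-filter-cons P? h {S} {S∷} S[] S-cons S∷-yes S∷-no = S∷-spec
  where
    S-spec : ∀ xs → S xs ≡ ∑[ y ∈ xs ] (𝟙 (P? y) * h y)
    S∷-spec : ∀ x xs d → S∷ x xs d ≡ 𝟙 d * h x + ∑[ y ∈ xs ] (𝟙 (P? y) * h y)
    S-spec []       = S[]
    S-spec (x ∷ xs) = trans (S-cons x xs) (S∷-spec x xs (P? x))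
    S∷-spec x xs (yes p) = trans (S∷-yes x xs p) (cong₂ _+_ (sym (ℕP.+-identityʳ (h x))) (S-spec xs))
    S∷-spec x xs (no p)  = trans (S∷-no x xs p) (S-spec xs)

coeffU≡∑ : ∀ (X : Digraph n) k (α : Fin k → ℕ) →
           coeffU X k α ≡ ∑[ π ∈ allFuns n n ] (𝟙 (isBijection? π) * coeffF X π k α)
coeffU≡∑ {n} X k α
  with allFuns n n
     | ∑-filter-cons isBijection? (λ π → coeffF X π k α)
         refl (λ _ _ → refl) (λ _ _ _ → refl) (λ _ _ _ → refl)
... | []     | _    = refl
... | π ∷ πs | cons with isBijection? π
...   | d = cons π πs d

isBijection-≗ : {π π′ : Fin n → Fin n} → π ≗ π′ → IsBijection π → IsBijection π′
isBijection-≗ π≗π′ (injective , surjective) =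
  (λ i j π′i≡π′j → injective i j (trans (π≗π′ i) (trans π′i≡π′j (sym (π≗π′ j))))) ,
  (λ v → let i , πi≡v = surjective v in i , trans (sym (π≗π′ i)) πi≡v)

compatibleSeq-≗ : ∀ (X : Digraph n) {π π′} {s s′ : Fin n → Fin k} → π ≗ π′ → s ≗ s′ →
                  CompatibleSeq X π s → CompatibleSeq X π′ s′
compatibleSeq-≗ X {π} {s = s} π≗π′ s≗s′ compatible i j adj =
  subst₂ (λ u v → toℕ u ≤ toℕ v) (s≗s′ i) (s≗s′ j) weak ,
  λ edge → subst₂ (λ u v → toℕ u < toℕ v) (s≗s′ i) (s≗s′ j)
             (strict (subst₂ (Digraph.Edge X) (sym (π≗π′ i)) (sym (π≗π′ j)) edge))
  where
    weak : toℕ (s i) ≤ toℕ (s j)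
    weak = proj₁ (compatible i j adj)
    strict : Digraph.Edge X (π i) (π j) → toℕ (s i) < toℕ (s j)
    strict = proj₂ (compatible i j adj)

hasContent-≗ : ∀ (α : Fin k → ℕ) {s s′ : Fin n → Fin k} →
               s ≗ s′ → HasContent s α → HasContent s′ α
hasContent-≗ {n = n} α s≗s′ content c =
  trans (count-≗ _ _ (allFin n) (λ j → trans (s≗s′ j)) (λ j → trans (sym (s≗s′ j)))) (content c)

coeffF-summand : Digraph n → (Fin n → Fin n) → (Fin k → ℕ) → (Fin n → Fin k) → ℕ
coeffF-summand X π α s = 𝟙 (compatibleSeq? X π s ×-dec hasContent? s α)

coeffF≡∑ : ∀ (X : Digraph n) π k (α : Fin k → ℕ) →
           coeffF X π k α ≡ ∑[ s ∈ allFuns n k ] coeffF-summand X π α s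
coeffF≡∑ {n} X π k α = count≡∑𝟙 _ (allFuns n k)

coeffF-summand-respects≗ : ∀ (X : Digraph n) π (α : Fin k → ℕ) → Respects≗ (coeffF-summand X π α)
coeffF-summand-respects≗ X π α = 𝟙-respects≗ _ λ s≗s′ (compatible , content) →
  compatibleSeq-≗ X (λ _ → refl) s≗s′ compatible , hasContent-≗ α s≗s′ content

coeffF-respects≗ : ∀ (X : Digraph n) k (α : Fin k → ℕ) → Respects≗ (λ π → coeffF X π k α)
coeffF-respects≗ {n} X k α π≗π′ = count-≗ _ _ (allFuns n k)
  (λ s (compatible , content) → compatibleSeq-≗ X π≗π′ (λ _ → refl) compatible , content)
  (λ s (compatible , content) → compatibleSeq-≗ X (sym ∘ π≗π′) (λ _ → refl) compatible , content)

isBijection-respects≗ : Respects≗ {n} (λ π → 𝟙 (isBijection? π))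
isBijection-respects≗ = 𝟙-respects≗ isBijection? isBijection-≗

compatibleSeq⇒weaklyIncreasing : ∀ (X : Digraph n) {π} {s : Fin n → Fin k} →
                                 CompatibleSeq X π s → WeaklyIncreasing s
compatibleSeq⇒weaklyIncreasing X compatible i j adj = proj₁ (compatible i j adj)

-- The number of vertices

ones : Fin k → ℕ
ones _ = 1

id-isBijection : IsBijection {n} (λ i → i)
id-isBijection = (λ i j i≡j → i≡j) , (λ v → v , refl)

id-compatibleSeq : ∀ (X : Digraph n) → CompatibleSeq X (λ i → i) (λ i → i)
id-compatibleSeq X i j adj = ℕP.<⇒≤ i<j , λ _ → i<j
  where
    i<j : toℕ i < toℕ j
    i<j = ℕP.≤-reflexive (sym adj)

id-hasContent : HasContent {n} (λ i → i) ones
id-hasContent {n} c = begin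
  count (λ j → j ≟ c) (allFin n)     ≡⟨ count≡∑𝟙 _ (allFin n) ⟩
  ∑[ j ∈ allFin n ] 𝟙 (j ≟ c)        ≡⟨ ∑-allFin-single _ c (λ j j≢c → 𝟙-no (j ≟ c) j≢c) ⟩
  𝟙 (c ≟ c)                          ≡⟨ 𝟙-yes (c ≟ c) refl ⟩
  1                                  ∎
  where open ≡-Reasoning

coeffU-ones-positive : ∀ (X : Digraph n) → 1 ≤ coeffU X n ones
coeffU-ones-positive {n} X = begin
  1
    ≡⟨ 𝟙-yes (compatibleSeq? X ι ι ×-dec hasContent? ι ones) (id-compatibleSeq X , id-hasContent) ⟨
  coeffF-summand X ι ones ι
    ≤⟨ ∑-allFuns-≥ _ (coeffF-summand-respects≗ X ι ones) ι ⟩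
  ∑[ s ∈ allFuns n n ] coeffF-summand X ι ones s
    ≡⟨ coeffF≡∑ X ι n ones ⟨
  coeffF X ι n ones
    ≡⟨ ℕP.*-identityˡ _ ⟨
  1 * coeffF X ι n ones
    ≡⟨ cong (_* coeffF X ι n ones) (𝟙-yes (isBijection? ι) id-isBijection) ⟨
  𝟙 (isBijection? ι) * coeffF X ι n ones
    ≤⟨ ∑-allFuns-≥ _ (*-respects≗ isBijection-respects≗ (coeffF-respects≗ X n ones)) ι ⟩
  ∑[ π ∈ allFuns n n ] (𝟙 (isBijection? π) * coeffF X π n ones)
    ≡⟨ coeffU≡∑ X n ones ⟨
  coeffU X n ones
    ∎
  where
    open ℕP.≤-Reasoning
    ι : Fin n → Fin n
    ι i = i

surjective⇒≤ : ∀ (f : Fin m → Fin n) → (∀ c → ∃ λ i → f i ≡ c) → n ≤ m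
surjective⇒≤ {m = m} {n = n} f surjective = FinP.injective⇒≤ {f = section} λ {c} {c′} eq →
  trans (sym (proj₂ (surjective c))) (trans (cong f eq) (proj₂ (surjective c′)))
  where
    section : Fin n → Fin m
    section c = proj₁ (surjective c)

coeffU-ones≢0⇒≤ : ∀ (Y : Digraph m) → coeffU Y n ones ≢ 0 → n ≤ m
coeffU-ones≢0⇒≤ {m} {n} Y coeffU≢0 = surjective⇒≤ s (λ c → count≢0⇒∃ _ (allFin m) (count≢0 c))
  where
    listing : ∃ λ π → 𝟙 (isBijection? π) * coeffF Y π n ones ≢ 0
    listing = ∑≢0⇒∃ (allFuns m m) _ (coeffU≢0 ∘ trans (coeffU≡∑ Y n ones))
    π : Fin m → Fin m
    π = proj₁ listing
    coeffF≢0 : coeffF Y π n ones ≢ 0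
    coeffF≢0 coeffF≡0 =
      proj₂ listing (trans (cong (𝟙 (isBijection? π) *_) coeffF≡0) (ℕP.*-zeroʳ (𝟙 (isBijection? π))))
    sequence : ∃ λ s → CompatibleSeq Y π s × HasContent s ones
    sequence = count≢0⇒∃ _ (allFuns m n) coeffF≢0
    s : Fin m → Fin n
    s = proj₁ sequence
    count≢0 : ∀ c → count (λ j → s j ≟ c) (allFin m) ≢ 0
    count≢0 c count≡0 = ℕP.1+n≢0 (trans (sym (proj₂ (proj₂ sequence) c)) count≡0)

_≈U_ : Digraph n → Digraph m → Set
X ≈U Y = ∀ k α → coeffU X k α ≡ coeffU Y k α

vertexCount-determined : ∀ (X : Digraph n) (Y : Digraph m) → X ≈U Y → n ≡ m
vertexCount-determined {n} {m} X Y X≈Y = ℕP.≤-antisym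
  (coeffU-ones≢0⇒≤ Y (subst (_≢ 0) (X≈Y n ones) (ℕP.n>0⇒n≢0 (coeffU-ones-positive X))))
  (coeffU-ones≢0⇒≤ X (subst (_≢ 0) (sym (X≈Y m ones)) (ℕP.n>0⇒n≢0 (coeffU-ones-positive Y))))

-- The coefficient of x₁² x₂ ⋯ x_{n-1}

firstSquared : Fin (suc m) → ℕ
firstSquared zero    = 2
firstSquared (suc _) = 1

repeatFirst : Fin (suc (suc m)) → Fin (suc m)
repeatFirst zero    = zero
repeatFirst (suc j) = j

repeatFirst-hasContent : HasContent (repeatFirst {m}) firstSquared
repeatFirst-hasContent {m} c = begin
  count (λ j → repeatFirst j ≟ c) (allFin (suc (suc m)))
    ≡⟨ count≡∑𝟙 (λ j → repeatFirst j ≟ c) (allFin (suc (suc m))) ⟩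
  ∑[ j ∈ allFin (suc (suc m)) ] 𝟙 (repeatFirst j ≟ c)
    ≡⟨ ∑-allFin-suc (λ j → 𝟙 (repeatFirst j ≟ c)) ⟩
  𝟙 (zero ≟ c) + ∑[ j ∈ allFin (suc m) ] 𝟙 (j ≟ c)
    ≡⟨ cong (𝟙 (zero ≟ c) +_) (count≡∑𝟙 (λ j → j ≟ c) (allFin (suc m))) ⟨
  𝟙 (zero ≟ c) + count (λ j → j ≟ c) (allFin (suc m))
    ≡⟨ cong (𝟙 (zero ≟ c) +_) (id-hasContent c) ⟩
  𝟙 (zero ≟ c) + 1
    ≡⟨ multiplicity c ⟩
  firstSquared c
    ∎
  where
    open ≡-Reasoning
    multiplicity : ∀ c → 𝟙 (zero ≟ c) + 1 ≡ firstSquared c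
    multiplicity zero    = refl
    multiplicity (suc _) = refl

repeatFirst-weaklyIncreasing : WeaklyIncreasing (repeatFirst {m})
repeatFirst-weaklyIncreasing zero    j       _   = z≤n
repeatFirst-weaklyIncreasing (suc i) (suc j) adj =
  ℕP.≤-trans (ℕP.n≤1+n (toℕ i)) (ℕP.≤-reflexive (sym (ℕP.suc-injective adj)))

repeatFirst-compatible : ∀ (X : Digraph (suc (suc m))) π →
  CompatibleSeq X π repeatFirst ⇔ (¬ Digraph.Edge X (π zero) (π (suc zero)))
repeatFirst-compatible X π =
  mk⇔ (λ compatible edge → ℕP.n≮n 0 (proj₂ (compatible zero (suc zero) refl) edge)) compatible
  where
    compatible : ¬ Digraph.Edge X (π zero) (π (suc zero)) → CompatibleSeq X π repeatFirst
    compatible ¬edge zero    (suc zero) refl = z≤n , λ edge → ⊥-elim (¬edge edge)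
    compatible ¬edge (suc i) (suc j)    adj  =
      repeatFirst-weaklyIncreasing (suc i) (suc j) adj , λ _ → ℕP.≤-reflexive (sym (ℕP.suc-injective adj))

coeffF-firstSquared : ∀ (X : Digraph (suc (suc m))) π →
  coeffF X π (suc m) firstSquared ≡ 𝟙 (¬? (Digraph.edge? X (π zero) (π (suc zero))))
coeffF-firstSquared {m} X π = begin
  coeffF X π (suc m) firstSquared
    ≡⟨ coeffF≡∑ X π (suc m) firstSquared ⟩
  ∑[ s ∈ allFuns (suc (suc m)) (suc m) ] coeffF-summand X π firstSquared s
    ≡⟨ ∑-allFuns-single _ (coeffF-summand-respects≗ X π firstSquared) repeatFirst only-repeatFirst ⟩
  coeffF-summand X π firstSquared repeatFirst
    ≡⟨ 𝟙-cong _ _ (Equivalence.to (repeatFirst-compatible X π) ∘ proj₁)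
                  (λ ¬edge → Equivalence.from (repeatFirst-compatible X π) ¬edge , repeatFirst-hasContent) ⟩
  𝟙 (¬? (Digraph.edge? X (π zero) (π (suc zero))))
    ∎
  where
    open ≡-Reasoning
    only-repeatFirst : ∀ s → ¬ s ≗ repeatFirst → coeffF-summand X π firstSquared s ≡ 0
    only-repeatFirst s s≉ = 𝟙-no _ λ (compatible , content) →
      s≉ (weaklyIncreasing-determined-by-content firstSquared
            (compatibleSeq⇒weaklyIncreasing X compatible) repeatFirst-weaklyIncreasing
            content repeatFirst-hasContent)

-- The number of edges

edgeCount : Digraph n → ℕ
edgeCount {n} X = ∑[ a ∈ allFin n ] ∑[ b ∈ allFin n ] 𝟙 (Digraph.edge? X a b)

Irreflexive : Digraph n → Set
Irreflexive X = ∀ a → ¬ Digraph.Edge X a a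

listingCount : ℕ → ℕ
listingCount n = ∑[ π ∈ allFuns n n ] 𝟙 (isBijection? π)

startsWith : (a b : Fin (suc (suc m))) → (Fin (suc (suc m)) → Fin (suc (suc m))) → ℕ
startsWith a b π = (𝟙 (isBijection? π) * 𝟙 (π zero ≟ a)) * 𝟙 (π (suc zero) ≟ b)

listingsStartingWith : Fin (suc (suc m)) → Fin (suc (suc m)) → ℕ
listingsStartingWith {m} a b = ∑[ π ∈ allFuns (suc (suc m)) (suc (suc m)) ] startsWith a b π

startsWith-respects≗ : ∀ (a b : Fin (suc (suc m))) → Respects≗ (startsWith a b)
startsWith-respects≗ a b =
  *-respects≗ (*-respects≗ isBijection-respects≗ (value-respects≗ zero a)) (value-respects≗ (suc zero) b)
  where
    value-respects≗ : ∀ (i v : Fin (suc (suc m))) → Respects≗ (λ π → 𝟙 (π i ≟ v))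
    value-respects≗ i v = 𝟙-respects≗ (λ π → π i ≟ v) (λ π≗π′ → trans (sym (π≗π′ i)))

permutation-injective : ∀ (τ : Permutation n n) {x y} → τ ⟨$⟩ʳ x ≡ τ ⟨$⟩ʳ y → x ≡ y
permutation-injective τ = Injection.injective (↔⇒↣ τ)

isBijection-∘-permutation : ∀ (τ : Permutation n n) (π : Fin n → Fin n) →
                            𝟙 (isBijection? ((τ ⟨$⟩ʳ_) ∘ π)) ≡ 𝟙 (isBijection? π)
isBijection-∘-permutation τ π = 𝟙-cong (isBijection? _) (isBijection? π)
  (λ (injective , surjective) →
     (λ i j πi≡πj → injective i j (cong (τ ⟨$⟩ʳ_) πi≡πj)) ,
     (λ v → let i , τπi≡τv = surjective (τ ⟨$⟩ʳ v) in i , permutation-injective τ τπi≡τv))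
  (λ (injective , surjective) →
     (λ i j τπi≡τπj → injective i j (permutation-injective τ τπi≡τπj)) ,
     (λ v → let i , πi≡τ⁻¹v = surjective (τ ⟨$⟩ˡ v)
            in  i , trans (cong (τ ⟨$⟩ʳ_) πi≡τ⁻¹v) (Perm.inverseʳ τ)))

-- insert zero a σ sends zero to a and suc i to punchIn a (σ ⟨$⟩ʳ i).
sendingFirstTwoTo : ∀ (a b : Fin (suc (suc m))) → a ≢ b → Permutation (suc (suc m)) (suc (suc m))
sendingFirstTwoTo a b a≢b = Perm.insert zero a (Perm.insert zero (Fin.punchOut a≢b) Perm.id)

sendingFirstTwoTo-zero : ∀ (a b : Fin (suc (suc m))) (a≢b : a ≢ b) →
                         sendingFirstTwoTo a b a≢b ⟨$⟩ʳ zero ≡ a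
sendingFirstTwoTo-zero a b a≢b = refl

sendingFirstTwoTo-one : ∀ (a b : Fin (suc (suc m))) (a≢b : a ≢ b) →
                        sendingFirstTwoTo a b a≢b ⟨$⟩ʳ suc zero ≡ b
sendingFirstTwoTo-one a b a≢b = FinP.punchIn-punchOut a≢b

listingsStartingWith-invariant : ∀ (a b : Fin (suc (suc m))) → a ≢ b →
  listingsStartingWith a b ≡ listingsStartingWith {m} zero (suc zero)
listingsStartingWith-invariant {m} a b a≢b = begin
  ∑[ π ∈ allFuns N N ] startsWith a b π
    ≡⟨ ∑-allFuns-permute τ (startsWith a b) (startsWith-respects≗ a b) ⟨
  ∑[ π ∈ allFuns N N ] startsWith a b ((τ ⟨$⟩ʳ_) ∘ π)
    ≡⟨ ∑-cong (allFuns N N) relabel ⟩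
  ∑[ π ∈ allFuns N N ] startsWith zero (suc zero) π
    ∎
  where
    open ≡-Reasoning
    N : ℕ
    N = suc (suc m)
    τ : Permutation N N
    τ = sendingFirstTwoTo a b a≢b
    value-∘-permutation : ∀ {x c v} → τ ⟨$⟩ʳ c ≡ v → 𝟙 (τ ⟨$⟩ʳ x ≟ v) ≡ 𝟙 (x ≟ c)
    value-∘-permutation τc≡v = 𝟙-cong (_ ≟ _) (_ ≟ _)
      (λ τx≡v → permutation-injective τ (trans τx≡v (sym τc≡v)))
      (λ x≡c → trans (cong (τ ⟨$⟩ʳ_) x≡c) τc≡v)
    relabel : ∀ π → startsWith a b ((τ ⟨$⟩ʳ_) ∘ π) ≡ startsWith zero (suc zero) π
    relabel π = cong₂ _*_
      (cong₂ _*_ (isBijection-∘-permutation τ π) (value-∘-permutation (sendingFirstTwoTo-zero a b a≢b)))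
      (value-∘-permutation (sendingFirstTwoTo-one a b a≢b))

listingsStartingWith-positive : 1 ≤ listingsStartingWith {m} zero (suc zero)
listingsStartingWith-positive {m} = begin
  1
    ≡⟨ cong (λ b → (b * 1) * 1) (𝟙-yes (isBijection? ι) id-isBijection) ⟨
  startsWith {m} zero (suc zero) ι
    ≤⟨ ∑-allFuns-≥ _ (startsWith-respects≗ zero (suc zero)) ι ⟩
  listingsStartingWith {m} zero (suc zero)
    ∎
  where
    open ℕP.≤-Reasoning
    ι : Fin (suc (suc m)) → Fin (suc (suc m))
    ι i = i

edge-startsWith-sift : ∀ (X : Digraph (suc (suc m))) π →
  ∑[ a ∈ allFin (suc (suc m)) ] ∑[ b ∈ allFin (suc (suc m)) ] (𝟙 (Digraph.edge? X a b) * startsWith a b π)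
  ≡ 𝟙 (isBijection? π) * 𝟙 (Digraph.edge? X (π zero) (π (suc zero)))
edge-startsWith-sift {m} X π = begin
  ∑[ a ∈ allFin N ] ∑[ b ∈ allFin N ] (E a b * ((β * δ (π zero) a) * δ (π (suc zero)) b))
    ≡⟨ ∑-cong (allFin N) (λ a → ∑-cong (allFin N) (λ b → sym (ℕP.*-assoc (E a b) _ _))) ⟩
  ∑[ a ∈ allFin N ] ∑[ b ∈ allFin N ] ((E a b * (β * δ (π zero) a)) * δ (π (suc zero)) b)
    ≡⟨ ∑-cong (allFin N) (λ a → ∑-allFin-sift (λ b → E a b * (β * δ (π zero) a)) (π (suc zero))) ⟩
  ∑[ a ∈ allFin N ] (E a (π (suc zero)) * (β * δ (π zero) a))
    ≡⟨ ∑-cong (allFin N) (λ a → sym (ℕP.*-assoc (E a (π (suc zero))) β _)) ⟩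
  ∑[ a ∈ allFin N ] ((E a (π (suc zero)) * β) * δ (π zero) a)
    ≡⟨ ∑-allFin-sift (λ a → E a (π (suc zero)) * β) (π zero) ⟩
  E (π zero) (π (suc zero)) * β
    ≡⟨ ℕP.*-comm (E (π zero) (π (suc zero))) β ⟩
  β * E (π zero) (π (suc zero))
    ∎
  where
    open ≡-Reasoning
    N : ℕ
    N = suc (suc m)
    E : Fin N → Fin N → ℕ
    E a b = 𝟙 (Digraph.edge? X a b)
    β : ℕ
    β = 𝟙 (isBijection? π)
    δ : Fin N → Fin N → ℕ
    δ x y = 𝟙 (x ≟ y)

∑-listings-edge : ∀ (X : Digraph (suc (suc m))) → Irreflexive X →
  ∑[ π ∈ allFuns (suc (suc m)) (suc (suc m)) ]
    (𝟙 (isBijection? π) * 𝟙 (Digraph.edge? X (π zero) (π (suc zero))))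
  ≡ edgeCount X * listingsStartingWith {m} zero (suc zero)
∑-listings-edge {m} X irreflexive = begin
  ∑[ π ∈ Π ] (𝟙 (isBijection? π) * E (π zero) (π (suc zero)))
    ≡⟨ ∑-cong Π (edge-startsWith-sift X) ⟨
  ∑[ π ∈ Π ] ∑[ a ∈ allFin N ] ∑[ b ∈ allFin N ] (E a b * startsWith a b π)
    ≡⟨ ∑-comm Π (allFin N) _ ⟩
  ∑[ a ∈ allFin N ] ∑[ π ∈ Π ] ∑[ b ∈ allFin N ] (E a b * startsWith a b π)
    ≡⟨ ∑-cong (allFin N) (λ a → ∑-comm Π (allFin N) _) ⟩
  ∑[ a ∈ allFin N ] ∑[ b ∈ allFin N ] ∑[ π ∈ Π ] (E a b * startsWith a b π)
    ≡⟨ ∑-cong (allFin N) (λ a → ∑-cong (allFin N) (λ b → ∑-*ˡ Π (E a b) (startsWith a b))) ⟩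
  ∑[ a ∈ allFin N ] ∑[ b ∈ allFin N ] (E a b * listingsStartingWith a b)
    ≡⟨ ∑-cong (allFin N) (λ a → ∑-cong (allFin N) (only-edges a)) ⟩
  ∑[ a ∈ allFin N ] ∑[ b ∈ allFin N ] (E a b * K)
    ≡⟨ ∑-cong (allFin N) (λ a → ∑-*ʳ (allFin N) (E a) K) ⟩
  ∑[ a ∈ allFin N ] ((∑[ b ∈ allFin N ] E a b) * K)
    ≡⟨ ∑-*ʳ (allFin N) (λ a → ∑[ b ∈ allFin N ] E a b) K ⟩
  edgeCount X * K
    ∎
  where
    open ≡-Reasoning
    N : ℕ
    N = suc (suc m)
    Π : List (Fin N → Fin N)
    Π = allFuns N N
    K : ℕ
    K = listingsStartingWith {m} zero (suc zero)
    E : Fin N → Fin N → ℕ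
    E a b = 𝟙 (Digraph.edge? X a b)
    only-edges : ∀ a b → E a b * listingsStartingWith a b ≡ E a b * K
    only-edges a b with Digraph.edge? X a b
    ... | yes edge = cong (1 *_) (listingsStartingWith-invariant a b λ { refl → irreflexive a edge })
    ... | no  _    = refl

coeffU-firstSquared+edges : ∀ (X : Digraph (suc (suc m))) → Irreflexive X →
  coeffU X (suc m) firstSquared + edgeCount X * listingsStartingWith {m} zero (suc zero)
  ≡ listingCount (suc (suc m))
coeffU-firstSquared+edges {m} X irreflexive = begin
  coeffU X (suc m) firstSquared + edgeCount X * listingsStartingWith {m} zero (suc zero)
    ≡⟨ cong₂ _+_ (trans (coeffU≡∑ X (suc m) firstSquared)
                        (∑-cong Π (λ π → cong (β π *_) (coeffF-firstSquared X π))))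
                 (sym (∑-listings-edge X irreflexive)) ⟩
  ∑[ π ∈ Π ] (β π * 𝟙 (¬? (edge? π))) + ∑[ π ∈ Π ] (β π * 𝟙 (edge? π))
    ≡⟨ ∑-+ Π _ _ ⟨
  ∑[ π ∈ Π ] (β π * 𝟙 (¬? (edge? π)) + β π * 𝟙 (edge? π))
    ≡⟨ ∑-cong Π (λ π → sym (ℕP.*-distribˡ-+ (β π) _ _)) ⟩
  ∑[ π ∈ Π ] (β π * (𝟙 (¬? (edge? π)) + 𝟙 (edge? π)))
    ≡⟨ ∑-cong Π (λ π → trans (cong (β π *_) (𝟙-¬?+𝟙 (edge? π))) (ℕP.*-identityʳ (β π))) ⟩
  listingCount (suc (suc m))
    ∎
  where
    open ≡-Reasoning
    Π : List (Fin (suc (suc m)) → Fin (suc (suc m)))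
    Π = allFuns (suc (suc m)) (suc (suc m))
    β : (Fin (suc (suc m)) → Fin (suc (suc m))) → ℕ
    β π = 𝟙 (isBijection? π)
    edge? : ∀ π → Dec (Digraph.Edge X (π zero) (π (suc zero)))
    edge? π = Digraph.edge? X (π zero) (π (suc zero))

edgeCount-determined : ∀ (X : Digraph n) (Y : Digraph m) → Irreflexive X → Irreflexive Y →
                       n ≡ m → X ≈U Y → edgeCount X ≡ edgeCount Y
edgeCount-determined {zero}        X Y _     _     refl _   = refl
edgeCount-determined {suc zero}    X Y X-irr Y-irr refl _   =
  cong (λ e → (e + 0) + 0) (trans (𝟙-no _ (X-irr zero)) (sym (𝟙-no _ (Y-irr zero))))
edgeCount-determined {suc (suc m)} X Y X-irr Y-irr refl X≈Y =
  ℕP.*-cancelʳ-≡ (edgeCount X) (edgeCount Y) K {{ℕ.>-nonZero (listingsStartingWith-positive {m})}}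
    (ℕP.+-cancelˡ-≡ (coeffU X (suc m) firstSquared) _ _ (begin
      coeffU X (suc m) firstSquared + edgeCount X * K ≡⟨ coeffU-firstSquared+edges X X-irr ⟩
      listingCount (suc (suc m))                      ≡⟨ coeffU-firstSquared+edges Y Y-irr ⟨
      coeffU Y (suc m) firstSquared + edgeCount Y * K ≡⟨ cong (_+ edgeCount Y * K) (X≈Y (suc m) firstSquared) ⟨
      coeffU X (suc m) firstSquared + edgeCount Y * K ∎))
  where
    open ≡-Reasoning
    K : ℕ
    K = listingsStartingWith {m} zero (suc zero)

comparablePairs≡edgeCount : ∀ (P : FinPoset) → comparablePairs P ≡ edgeCount (D P)
comparablePairs≡edgeCount P = begin
  comparablePairs P
    ≡⟨ count≡∑𝟙 _ pairs ⟩
  ∑[ ab ∈ pairs ] 𝟙 (<P? (proj₁ ab) (proj₂ ab))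
    ≡⟨ ∑-concatMap _ (allFin size) _ ⟩
  ∑[ a ∈ allFin size ] ∑[ ab ∈ map (a ,_) (allFin size) ] 𝟙 (<P? (proj₁ ab) (proj₂ ab))
    ≡⟨ ∑-cong (allFin size) (λ a → ∑-map (a ,_) (allFin size) _) ⟩
  edgeCount (D P)
    ∎
  where
    open ≡-Reasoning
    open FinPoset P using (size; <P?)
    pairs : List (Fin size × Fin size)
    pairs = concatMap (λ i → map (λ j → (i , j)) (allFin size)) (allFin size)

D-irreflexive : ∀ (P : FinPoset) → Irreflexive (D P)
D-irreflexive P a = IsStrictPartialOrder.irrefl (FinPoset.isSPO P) refl

mainTheorem10 : (P Q : FinPoset) → U-Equal P Q →
    (FinPoset.size P ≡ FinPoset.size Q) × (comparablePairs P ≡ comparablePairs Q)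
mainTheorem10 P Q U≡ = size≡ , (begin
  comparablePairs P ≡⟨ comparablePairs≡edgeCount P ⟩
  edgeCount (D P)   ≡⟨ edgeCount-determined (D P) (D Q) (D-irreflexive P) (D-irreflexive Q) size≡ U≡ ⟩
  edgeCount (D Q)   ≡⟨ comparablePairs≡edgeCount Q ⟨
  comparablePairs Q ∎)
  where
    open ≡-Reasoning
    size≡ : FinPoset.size P ≡ FinPoset.size Q
    size≡ = vertexCount-determined (D P) (D Q) U≡
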